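{- For all integers $n\ge 1$ and all $j,k$ with $1\le j\le k\le n$, we have $b_{j,k}(n) = \binom{n-k+j-1}{j-1}$.
   Context: A Catalan path of semilength $m$ is a word of $m$ letters $N$ and $m$ letters $E$ such that every initial segment contains at least as many $N$'s as $E$'s. For a positive integer $n$ and integers $j,k$ with $0\le j\le n$ and $1\le k\le n$, a $j,k$-Catalan path of semilength $n$ is a word $p$ consisting of $j$ letters $N$ and $n$ letters $E$ such that (1) the word $N^{n-j}p$ (i.e. $n-j$ copies of $N$ followed by $p$) is a Catalan path, and (2) either the last $k+1$ letters of $p$ are $N$ followed by $k$ copies of $E$, or $k=n$ and $p$ consists of $n$ copies of $E$. $b_{j,k}(n)$ denotes the number of $j,k$-Catalan paths of semilength $n$. -}

module Defs where

open import Data.Nat using (ℕ; zero; suc; _+_; _∸_; _≤_; _≟_; _≤?_)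
open import Data.List using (List; []; _∷_; _++_; replicate; length; filter; map; concatMap; inits; reverse)
open import Data.List.Relation.Unary.All using (All; all?)
open import Data.Product using (Σ; _×_; _,_; ∃)
open import Data.Sum using (_⊎_; inj₁; inj₂)
open import Relation.Binary.PropositionalEquality using (_≡_; refl; cong)
open import Relation.Nullary using (Dec; yes; no; ¬_)
open import Relation.Nullary.Decidable using (_×-dec_; _⊎-dec_; map′)

data Letter : Set where
  N E : Letter

_≟L_ : (a b : Letter) → Dec (a ≡ b)
N ≟L N = yes refl
N ≟L E = no λ ()
E ≟L N = no λ ()
E ≟L E = yes refl

Word : Set
Word = List Letter

#N #E : Word → ℕ
#N [] = 0
#N (N ∷ w) = suc (#N w)
#N (E ∷ w) = #N w
#E [] = 0
#E (N ∷ w) = #E w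
#E (E ∷ w) = suc (#E w)

IsCatalan : Word → Set
IsCatalan w = (#N w ≡ #E w) × All (λ u → #E u ≤ #N u) (inits w)

IsJKPath : ℕ → ℕ → ℕ → Word → Set
IsJKPath n j k p =
  (#N p ≡ j) × (#E p ≡ n) ×
  IsCatalan (replicate (n ∸ j) N ++ p) ×
  ((Σ Word λ q → p ≡ q ++ (N ∷ replicate k E)) ⊎ (k ≡ n × p ≡ replicate n E))

words : ℕ → List Word
words zero = [] ∷ []
words (suc m) = map (N ∷_) (words m) ++ map (E ∷_) (words m)

≡W? : (u v : Word) → Dec (u ≡ v)
≡W? [] [] = yes refl
≡W? [] (_ ∷ _) = no λ ()
≡W? (_ ∷ _) [] = no λ ()
≡W? (a ∷ u) (b ∷ v) with a ≟L b | ≡W? u v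
... | yes refl | yes refl = yes refl
... | no a≢b | _ = no λ { refl → a≢b refl }
... | yes _ | no u≢v = no λ { refl → u≢v refl }

private
  tail≡ : ∀ {x y : Letter} {u v : Word} → x ∷ u ≡ y ∷ v → u ≡ v
  tail≡ refl = refl

EndsWith? : (s p : Word) → Dec (Σ Word λ q → p ≡ q ++ s)
EndsWith? s [] with ≡W? [] s
... | yes eq = yes ([] , eq)
... | no ne = no λ { ([] , eq) → ne eq ; (_ ∷ _ , ()) }
EndsWith? s (a ∷ p) with ≡W? (a ∷ p) s | EndsWith? s p
... | yes eq | _ = yes ([] , eq)
... | no ne | yes (q , eq) = yes (a ∷ q , cong (a ∷_) eq)
... | no ne | no nq = no λ { ([] , eq) → ne eq ; (b ∷ q , eq) → nq (q , tail≡ eq) }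

IsCatalan? : (w : Word) → Dec (IsCatalan w)
IsCatalan? w = (#N w ≟ #E w) ×-dec all? (λ u → #E u ≤? #N u) (inits w)

IsJKPath? : ∀ n j k p → Dec (IsJKPath n j k p)
IsJKPath? n j k p =
  (#N p ≟ j) ×-dec (#E p ≟ n) ×-dec IsCatalan? (replicate (n ∸ j) N ++ p) ×-dec
  (EndsWith? (N ∷ replicate k E) p ⊎-dec ((k ≟ n) ×-dec ≡W? p (replicate n E)))

-- b_{j,k}(n): the number of j,k-Catalan paths of semilength n.
-- Such a path has exactly j + n letters, so we count among all words of that length.
b : ℕ → ℕ → ℕ → ℕ
b j k n = length (filter (IsJKPath? n j k) (words (j + n)))

-- Write j = a + 1, k = j + t and n = k + c.  A j,k-Catalan path is exactly a word q N Eᵏ in which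
-- q has a letters N and c letters E: the letter counts force these numbers, and the prefix
-- N^(n-j) = N^(t+c) lifts the path high enough that any such q keeps it nonnegative, after which
-- the final k letters E bring it back to height 0.  Sorting words by their first letter gives
-- Pascal's rule for the number of such q, which is therefore C(a + c, a), and a + c = n - k + j - 1.
module Submission where

open import Defs
open import Data.Nat using (ℕ; zero; suc; _+_; _∸_; _≤_; _≟_)
open import Data.Nat.Properties
open import Data.Nat.Combinatorics using (_C_; nCk+nC[k+1]≡[n+1]C[k+1])
open import Data.Nat.Solver using (module +-*-Solver)
open import Data.List using (List; []; _∷_; _++_; replicate; length; filter; map; inits)
open import Data.List.Properties using (length-++; filter-++; filter-none; length-replicate; ∷-injective; ∷-injectiveˡ; ∷-injectiveʳ)
open import Data.List.Relation.Unary.All using (All; []; _∷_; universal) renaming (map to All-map)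
open import Data.List.Relation.Unary.All.Properties using (map⁺; map⁻)
open import Data.Product as Product using (Σ-syntax; _×_; _,_; proj₁; proj₂)
open import Data.Sum using (inj₁; inj₂)
open import Data.Empty using (⊥-elim)
open import Function using (_∘_; id)
open import Level using (Level)
open import Function.Bundles using (_⇔_; mk⇔; Equivalence)
open import Function.Construct.Composition using (_⇔-∘_)
open import Relation.Nullary using (yes; no; ¬_)
open import Relation.Unary using (Pred; Decidable)
open import Relation.Binary.PropositionalEquality
  using (_≡_; _≢_; refl; sym; trans; cong; cong₂; subst; subst₂; module ≡-Reasoning)

open Equivalence using (to; from)

private
  variable
    ℓ : Level
    P Q R : Pred Word ℓ

count : Decidable P → ℕ → ℕ
count P? m = length (filter P? (words m))

length-filter-map : {A B : Set} {S : Pred B ℓ} (S? : Decidable S) (f : A → B) (xs : List A) →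
  length (filter S? (map f xs)) ≡ length (filter (S? ∘ f) xs)
length-filter-map S? f [] = refl
length-filter-map S? f (x ∷ xs) with S? (f x)
... | yes _ = cong suc (length-filter-map S? f xs)
... | no _ = length-filter-map S? f xs

count-suc : (P? : Decidable P) (m : ℕ) →
  count P? (suc m) ≡ count (P? ∘ (N ∷_)) m + count (P? ∘ (E ∷_)) m
count-suc P? m = begin
  length (filter P? (map (N ∷_) (words m) ++ map (E ∷_) (words m)))
    ≡⟨ cong length (filter-++ P? (map (N ∷_) (words m)) _) ⟩
  length (filter P? (map (N ∷_) (words m)) ++ filter P? (map (E ∷_) (words m)))
    ≡⟨ length-++ (filter P? (map (N ∷_) (words m))) ⟩
  length (filter P? (map (N ∷_) (words m))) + length (filter P? (map (E ∷_) (words m)))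
    ≡⟨ cong₂ _+_ (length-filter-map P? (N ∷_) (words m)) (length-filter-map P? (E ∷_) (words m)) ⟩
  count (P? ∘ (N ∷_)) m + count (P? ∘ (E ∷_)) m
    ∎
  where open ≡-Reasoning

count-cong : (P? : Decidable P) (Q? : Decidable Q) (m : ℕ) →
  (∀ w → length w ≡ m → P w ⇔ Q w) → count P? m ≡ count Q? m
count-cong P? Q? zero P⇔Q with P? [] | Q? []
... | yes _ | yes _ = refl
... | no _ | no _ = refl
... | yes p | no ¬q = ⊥-elim (¬q (to (P⇔Q [] refl) p))
... | no ¬p | yes q = ⊥-elim (¬p (from (P⇔Q [] refl) q))
count-cong P? Q? (suc m) P⇔Q = begin
  count P? (suc m)
    ≡⟨ count-suc P? m ⟩
  count (P? ∘ (N ∷_)) m + count (P? ∘ (E ∷_)) m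
    ≡⟨ cong₂ _+_ (count-cong _ _ m (λ w → P⇔Q (N ∷ w) ∘ cong suc)) (count-cong _ _ m (λ w → P⇔Q (E ∷ w) ∘ cong suc)) ⟩
  count (Q? ∘ (N ∷_)) m + count (Q? ∘ (E ∷_)) m
    ≡⟨ count-suc Q? m ⟨
  count Q? (suc m)
    ∎
  where open ≡-Reasoning

count-empty : (P? : Decidable P) (m : ℕ) → (∀ w → length w ≡ m → ¬ P w) → count P? m ≡ 0
count-empty P? m ¬P = begin
  count P? m             ≡⟨ count-cong P? (λ _ → no id) m (λ w ∣w∣≡m → mk⇔ (¬P w ∣w∣≡m) ⊥-elim) ⟩
  count (λ _ → no id) m  ≡⟨ cong length (filter-none _ (universal (λ _ → id) (words m))) ⟩
  0                      ∎
  where open ≡-Reasoning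

count-#N : ∀ m a → count (λ w → #N w ≟ a) m ≡ m C a
count-#N zero zero = refl
count-#N zero (suc a) = refl
count-#N (suc m) zero = begin
  count (λ w → #N w ≟ 0) (suc m)                             ≡⟨ count-suc _ m ⟩
  count (λ w → suc (#N w) ≟ 0) m + count (λ w → #N w ≟ 0) m   ≡⟨ cong₂ _+_ (count-empty _ m λ _ _ ()) (count-#N m 0) ⟩
  m C 0                                                      ∎
  where open ≡-Reasoning
count-#N (suc m) (suc a) = begin
  count (λ w → #N w ≟ suc a) (suc m)
    ≡⟨ count-suc _ m ⟩
  count (λ w → suc (#N w) ≟ suc a) m + count (λ w → #N w ≟ suc a) m
    ≡⟨ cong (_+ count (λ w → #N w ≟ suc a) m) (count-cong _ _ m λ _ _ → mk⇔ suc-injective (cong suc)) ⟩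
  count (λ w → #N w ≟ a) m + count (λ w → #N w ≟ suc a) m
    ≡⟨ cong₂ _+_ (count-#N m a) (count-#N m (suc a)) ⟩
  m C a + m C suc a
    ≡⟨ nCk+nC[k+1]≡[n+1]C[k+1] m a ⟩
  suc m C suc a
    ∎
  where open ≡-Reasoning

module _ {C : Set ℓ} {x : Letter} {s : Word} (P⇔ : ∀ w → length w ≡ suc (length s) → P w ⇔ (w ≡ x ∷ s × C)) where

  ⇔-peel : ∀ w → length w ≡ length s → P (x ∷ w) ⇔ (w ≡ s × C)
  ⇔-peel w ∣w∣≡∣s∣ = mk⇔ (Product.map₁ ∷-injectiveʳ ∘ to x∷w⇔) λ { (refl , c) → from x∷w⇔ (refl , c) }
    where x∷w⇔ = P⇔ (x ∷ w) (cong suc ∣w∣≡∣s∣)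

  ⇔-mismatch : {y : Letter} → y ≢ x → ∀ w → length w ≡ length s → ¬ P (y ∷ w)
  ⇔-mismatch {y} y≢x w ∣w∣≡∣s∣ = y≢x ∘ ∷-injectiveˡ ∘ proj₁ ∘ to (P⇔ (y ∷ w) (cong suc ∣w∣≡∣s∣))

count-unique : (P? : Decidable P) (R? : Decidable R) (s : Word) →
  (∀ w → length w ≡ length s → P w ⇔ (w ≡ s × R [])) → count P? (length s) ≡ count R? 0
count-unique P? R? [] P⇔ = count-cong P? R? 0 λ
  { [] _ → mk⇔ (proj₂ ∘ to (P⇔ [] refl)) (λ r → from (P⇔ [] refl) (refl , r)) }
count-unique P? R? (N ∷ s) P⇔ = begin
  count P? (suc (length s))                                         ≡⟨ count-suc P? (length s) ⟩
  count (P? ∘ (N ∷_)) (length s) + count (P? ∘ (E ∷_)) (length s)  ≡⟨ cong₂ _+_ (count-unique _ R? s (⇔-peel P⇔))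
                                                                                 (count-empty _ _ (⇔-mismatch P⇔ λ ())) ⟩
  count R? 0 + 0                                                    ≡⟨ +-identityʳ _ ⟩
  count R? 0                                                        ∎
  where open ≡-Reasoning
count-unique P? R? (E ∷ s) P⇔ = begin
  count P? (suc (length s))                                         ≡⟨ count-suc P? (length s) ⟩
  count (P? ∘ (N ∷_)) (length s) + count (P? ∘ (E ∷_)) (length s)  ≡⟨ cong₂ _+_ (count-empty _ _ (⇔-mismatch P⇔ λ ()))
                                                                                 (count-unique _ R? s (⇔-peel P⇔)) ⟩
  count R? 0                                                        ∎
  where open ≡-Reasoning

suffix-unique : (s w : Word) → length w ≡ length s →
  (Σ[ q ∈ Word ] (w ≡ q ++ s × R q)) ⇔ (w ≡ s × R [])
suffix-unique {R = R} s w ∣w∣≡∣s∣ = mk⇔ to′ λ (w≡s , r) → [] , w≡s , r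
  where
  to′ : Σ[ q ∈ Word ] (w ≡ q ++ s × R q) → w ≡ s × R []
  to′ ([] , w≡s , r) = w≡s , r
  to′ (_ ∷ q , w≡q++s , _) = ⊥-elim (m≢1+n+m (length s)
    (trans (sym ∣w∣≡∣s∣) (trans (cong length w≡q++s) (cong suc (length-++ q)))))

suffix-∷ : (x : Letter) (s w : Word) (m : ℕ) → length w ≡ m + length s →
  (Σ[ q ∈ Word ] (x ∷ w ≡ q ++ s × R q)) ⇔ (Σ[ q ∈ Word ] (w ≡ q ++ s × R (x ∷ q)))
suffix-∷ {R = R} x s w m ∣w∣≡m+∣s∣ = mk⇔ to′ λ (q , w≡q++s , r) → x ∷ q , cong (x ∷_) w≡q++s , r
  where
  to′ : Σ[ q ∈ Word ] (x ∷ w ≡ q ++ s × R q) → Σ[ q ∈ Word ] (w ≡ q ++ s × R (x ∷ q))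
  to′ ([] , x∷w≡s , _) = ⊥-elim (m≢1+n+m (length s)
    (sym (trans (cong suc (sym ∣w∣≡m+∣s∣)) (cong length x∷w≡s))))
  to′ (_ ∷ q , x∷w≡q++s , r) with refl , w≡q++s ← ∷-injective x∷w≡q++s = q , w≡q++s , r

count-suffix : (P? : Decidable P) (R? : Decidable R) (s : Word) (m : ℕ) →
  (∀ w → length w ≡ m + length s → P w ⇔ (Σ[ q ∈ Word ] (w ≡ q ++ s × R q))) →
  count P? (m + length s) ≡ count R? m
count-suffix P? R? s zero P⇔ = count-unique P? R? s λ w ∣w∣≡∣s∣ → suffix-unique s w ∣w∣≡∣s∣ ⇔-∘ P⇔ w ∣w∣≡∣s∣
count-suffix {P = P} {R = R} P? R? s (suc m) P⇔ = begin
  count P? (suc m + length s)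
    ≡⟨ count-suc P? (m + length s) ⟩
  count (P? ∘ (N ∷_)) (m + length s) + count (P? ∘ (E ∷_)) (m + length s)
    ≡⟨ cong₂ _+_ (count-suffix _ (R? ∘ (N ∷_)) s m (shift N)) (count-suffix _ (R? ∘ (E ∷_)) s m (shift E)) ⟩
  count (R? ∘ (N ∷_)) m + count (R? ∘ (E ∷_)) m
    ≡⟨ count-suc R? m ⟨
  count R? (suc m)
    ∎
  where
  open ≡-Reasoning
  shift : ∀ x w → length w ≡ m + length s → P (x ∷ w) ⇔ (Σ[ q ∈ Word ] (w ≡ q ++ s × R (x ∷ q)))
  shift x w ∣w∣≡m+∣s∣ = suffix-∷ x s w m ∣w∣≡m+∣s∣ ⇔-∘ P⇔ (x ∷ w) (cong suc ∣w∣≡m+∣s∣)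

#N-++ : ∀ u v → #N (u ++ v) ≡ #N u + #N v
#N-++ [] v = refl
#N-++ (N ∷ u) v = cong suc (#N-++ u v)
#N-++ (E ∷ u) v = #N-++ u v

#E-++ : ∀ u v → #E (u ++ v) ≡ #E u + #E v
#E-++ [] v = refl
#E-++ (N ∷ u) v = #E-++ u v
#E-++ (E ∷ u) v = cong suc (#E-++ u v)

#N-replicate-N : ∀ r → #N (replicate r N) ≡ r
#N-replicate-N zero = refl
#N-replicate-N (suc r) = cong suc (#N-replicate-N r)

#E-replicate-N : ∀ r → #E (replicate r N) ≡ 0
#E-replicate-N zero = refl
#E-replicate-N (suc r) = #E-replicate-N r

#N-replicate-E : ∀ k → #N (replicate k E) ≡ 0
#N-replicate-E zero = refl
#N-replicate-E (suc k) = #N-replicate-E k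

#E-replicate-E : ∀ k → #E (replicate k E) ≡ k
#E-replicate-E zero = refl
#E-replicate-E (suc k) = cong suc (#E-replicate-E k)

#N+#E≡length : ∀ w → #N w + #E w ≡ length w
#N+#E≡length [] = refl
#N+#E≡length (N ∷ w) = cong suc (#N+#E≡length w)
#N+#E≡length (E ∷ w) = trans (+-suc (#N w) (#E w)) (cong suc (#N+#E≡length w))

+-#N-∷ : ∀ d x u → d + #N (x ∷ u) ≡ d + #N (x ∷ []) + #N u
+-#N-∷ d x u = trans (cong (d +_) (#N-++ (x ∷ []) u)) (sym (+-assoc d _ _))

+-#E-∷ : ∀ e x u → e + #E (x ∷ u) ≡ e + #E (x ∷ []) + #E u
+-#E-∷ e x u = trans (cong (e +_) (#E-++ (x ∷ []) u)) (sym (+-assoc e _ _))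

-- The prefix condition for a word read after d letters N and e letters E;
-- IsCatalan w unfolds to #N w ≡ #E w × Ballot 0 0 w.
Ballot : ℕ → ℕ → Word → Set
Ballot d e w = All (λ u → e + #E u ≤ d + #N u) (inits w)

ballot-∷ : ∀ {d e} x w →
  Ballot d e (x ∷ w) ⇔ (e ≤ d × Ballot (d + #N (x ∷ [])) (e + #E (x ∷ [])) w)
ballot-∷ {d} {e} x w = mk⇔
  (λ { (h ∷ hs) → subst id empty h , All-map (λ {u} → subst id (step u)) (map⁻ hs) })
  (λ (h , hs) → subst id (sym empty) h ∷ map⁺ (All-map (λ {u} → subst id (sym (step u))) hs))
  where
  empty : (e + 0 ≤ d + 0) ≡ (e ≤ d)
  empty = cong₂ _≤_ (+-identityʳ e) (+-identityʳ d)
  step : ∀ u → (e + #E (x ∷ u) ≤ d + #N (x ∷ u)) ≡ (e + #E (x ∷ []) + #E u ≤ d + #N (x ∷ []) + #N u)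
  step u = cong₂ _≤_ (+-#E-∷ e x u) (+-#N-∷ d x u)

ballot-++ : ∀ {d e} u v → Ballot d e u → Ballot (d + #N u) (e + #E u) v → Ballot d e (u ++ v)
ballot-++ {d} {e} [] v _ hv = subst₂ (λ d′ e′ → Ballot d′ e′ v) (+-identityʳ d) (+-identityʳ e) hv
ballot-++ {d} {e} (x ∷ u) v hxu hv with e≤d , hu ← to (ballot-∷ x u) hxu =
  from (ballot-∷ x (u ++ v))
    (e≤d , ballot-++ u v hu (subst₂ (λ d′ e′ → Ballot d′ e′ v) (+-#N-∷ d x u) (+-#E-∷ e x u) hv))

ballot-≤ : ∀ {d e} w → e + #E w ≤ d → Ballot d e w
ballot-≤ {d} {e} [] e≤d = ≤-trans e≤d (m≤m+n d 0) ∷ []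
ballot-≤ {d} {e} (x ∷ w) bound = from (ballot-∷ x w)
  ( ≤-trans (m≤m+n e _) bound
  , ballot-≤ w (≤-trans (≤-reflexive (sym (+-#E-∷ e x w))) (≤-trans bound (m≤m+n d _))))

#N-shape : ∀ q k → #N (q ++ N ∷ replicate k E) ≡ suc (#N q)
#N-shape q k = trans (#N-++ q _) (trans (cong (λ z → #N q + suc z) (#N-replicate-E k)) (+-comm (#N q) 1))

#E-shape : ∀ q k → #E (q ++ N ∷ replicate k E) ≡ #E q + k
#E-shape q k = trans (#E-++ q _) (cong (#E q +_) (#E-replicate-E k))

catalan-shape : ∀ t q → IsCatalan (replicate (t + #E q) N ++ q ++ N ∷ replicate (suc (#N q) + t) E)
catalan-shape t q = balanced , ballot-++ (replicate r N) p (ballot-≤ (replicate r N) (≤-reflexive (#E-replicate-N r)))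
  (subst₂ (λ d e → Ballot d e p) (sym (#N-replicate-N r)) (sym (#E-replicate-N r)) ballot-p)
  where
  a c k r : ℕ
  a = #N q
  c = #E q
  k = suc a + t
  r = t + c
  p : Word
  p = q ++ N ∷ replicate k E
  open +-*-Solver
  balanced : #N (replicate r N ++ p) ≡ #E (replicate r N ++ p)
  balanced = begin
    #N (replicate r N ++ p)             ≡⟨ #N-++ (replicate r N) p ⟩
    #N (replicate r N) + #N p           ≡⟨ cong₂ _+_ (#N-replicate-N r) (#N-shape q k) ⟩
    t + c + suc a                       ≡⟨ solve 3 (λ a t c → t :+ c :+ (con 1 :+ a) := c :+ (con 1 :+ a :+ t)) refl a t c ⟩
    0 + (c + k)                         ≡⟨ cong₂ _+_ (#E-replicate-N r) (#E-shape q k) ⟨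
    #E (replicate r N) + #E p           ≡⟨ #E-++ (replicate r N) p ⟨
    #E (replicate r N ++ p)             ∎
    where open ≡-Reasoning
  final-run : c + 0 + #E (replicate k E) ≤ r + a + 1
  final-run = ≤-reflexive (trans (cong (c + 0 +_) (#E-replicate-E k))
    (solve 3 (λ a t c → c :+ con 0 :+ (con 1 :+ a :+ t) := t :+ c :+ a :+ con 1) refl a t c))
  ballot-p : Ballot r 0 p
  ballot-p = ballot-++ q (N ∷ replicate k E) (ballot-≤ q (m≤n+m c t))
    (from (ballot-∷ N (replicate k E)) (≤-trans (m≤n+m c t) (m≤m+n r a) , ballot-≤ (replicate k E) final-run))

shape⇒jk-path : ∀ t q →
  IsJKPath (suc (#N q) + t + #E q) (suc (#N q)) (suc (#N q) + t) (q ++ N ∷ replicate (suc (#N q) + t) E)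
shape⇒jk-path t q =
  #N-shape q k , trans (#E-shape q k) (+-comm (#E q) k) ,
  subst (λ r → IsCatalan (replicate r N ++ q ++ N ∷ replicate k E)) (sym n∸j≡t+c) (catalan-shape t q) ,
  inj₁ (q , refl)
  where
  k : ℕ
  k = suc (#N q) + t
  n∸j≡t+c : k + #E q ∸ suc (#N q) ≡ t + #E q
  n∸j≡t+c = trans (cong (_∸ suc (#N q)) (+-assoc (suc (#N q)) t (#E q))) (m+n∸m≡n (suc (#N q)) (t + #E q))

jk-path⇔shape : ∀ a t c p → length p ≡ a + c + length (N ∷ replicate (suc a + t) E) →
  IsJKPath (suc a + t + c) (suc a) (suc a + t) p ⇔
  (Σ[ q ∈ Word ] (p ≡ q ++ N ∷ replicate (suc a + t) E × #N q ≡ a))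
jk-path⇔shape a t c p ∣p∣ = mk⇔ to′ from′
  where
  k : ℕ
  k = suc a + t
  s : Word
  s = N ∷ replicate k E
  to′ : IsJKPath (k + c) (suc a) k p → Σ[ q ∈ Word ] (p ≡ q ++ s × #N q ≡ a)
  to′ (#Np≡j , _ , _ , inj₁ (q , p≡q++s)) =
    q , p≡q++s , suc-injective (trans (sym (#N-shape q k)) (trans (cong #N (sym p≡q++s)) #Np≡j))
  to′ (#Np≡j , _ , _ , inj₂ (_ , p≡Eⁿ)) =
    ⊥-elim (0≢1+n (trans (sym (#N-replicate-E (k + c))) (trans (cong #N (sym p≡Eⁿ)) #Np≡j)))
  from′ : Σ[ q ∈ Word ] (p ≡ q ++ s × #N q ≡ a) → IsJKPath (k + c) (suc a) k p
  from′ (q , refl , #Nq≡a) =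
    subst₂ (λ a′ c′ → IsJKPath (suc a′ + t + c′) (suc a′) (suc a′ + t) (q ++ N ∷ replicate (suc a′ + t) E))
      #Nq≡a #Eq≡c (shape⇒jk-path t q)
    where
    ∣q∣≡a+c : length q ≡ a + c
    ∣q∣≡a+c = +-cancelʳ-≡ (length s) _ _ (trans (sym (length-++ q)) ∣p∣)
    #Eq≡c : #E q ≡ c
    #Eq≡c = +-cancelˡ-≡ a _ _ (trans (cong (_+ #E q) (sym #Nq≡a)) (trans (#N+#E≡length q) ∣q∣≡a+c))

theorem5p8 : (n j k : ℕ) → 1 ≤ n → 1 ≤ j → j ≤ k → k ≤ n →
    b j k n ≡ (n ∸ k + j ∸ 1) C (j ∸ 1)
theorem5p8 n (suc a) k _ _ j≤k k≤n with t , refl ← m≤n⇒∃[o]m+o≡n j≤k | c , refl ← m≤n⇒∃[o]m+o≡n k≤n = begin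
  count (IsJKPath? n j k) (j + n)
    ≡⟨ cong (count (IsJKPath? n j k)) length-split ⟩
  count (IsJKPath? n j k) (a + c + length (N ∷ replicate k E))
    ≡⟨ count-suffix _ (λ q → #N q ≟ a) (N ∷ replicate k E) (a + c) (jk-path⇔shape a t c) ⟩
  count (λ q → #N q ≟ a) (a + c)
    ≡⟨ count-#N (a + c) a ⟩
  (a + c) C a
    ≡⟨ cong (_C a) (+-comm a c) ⟩
  (c + a) C a
    ≡⟨ cong (λ m → (m ∸ 1) C a) (+-suc c a) ⟨
  (c + suc a ∸ 1) C a
    ≡⟨ cong (λ m → (m + suc a ∸ 1) C a) (m+n∸m≡n k c) ⟨
  (n ∸ k + j ∸ 1) C (j ∸ 1)
    ∎
  where
  open ≡-Reasoning
  open +-*-Solver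
  j : ℕ
  j = suc a
  length-split : j + n ≡ a + c + length (N ∷ replicate k E)
  length-split = trans (solve 3 (λ a t c → con 1 :+ a :+ (con 1 :+ a :+ t :+ c) := a :+ c :+ (con 1 :+ (con 1 :+ a :+ t))) refl a t c)
    (cong (λ l → a + c + suc l) (sym (length-replicate k)))
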